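{- Let $\alpha\colon X\to\mathcal{P}(\Sigma_\tau\times\mathbb{T}\times X)$ be a timed transition system with functor model $\underline{\alpha}$, and let $R$ be an equivalence relation on $X$. Then $R$ is a timed bisimulation for $\alpha$ if and only if $R$ is an $id_{\mathbb{T}^\ast}$-bisimulation for $\underline{\alpha}$.
   Context: $\Sigma$ is a set, $\Sigma_\tau=\Sigma+\{\tau\}$, and $(\mathbb{T},\cdot,0)$ is a monoid (of time durations). Write $x\xrightarrow{\sigma}_t y$ iff $(\sigma,t,y)\in\alpha(x)$. $R$ is a timed bisimulation for $\alpha$ if whenever $x\mathrel{R}y$ and $x\xrightarrow{\sigma}_t x'$ there is $y'$ with $y\xrightarrow{\sigma}_t y'$ and $x'\mathrel{R}y'$. The category $\mathbf{K}$ has sets as objects, morphisms $X\to Y$ the functions $f\colon X\to\mathcal{P}(\Sigma_\tau\times Y)$, identity $x\mapsto\{(\tau,x)\}$, composition $(g\circ f)(x)=\{(\sigma,z)\mid\exists y:\ ((\sigma,y)\in f(x),(\tau,z)\in g(y))\text{ or }((\tau,y)\in f(x),(\sigma,z)\in g(y))\}$, ordered pointwise by inclusion (joins are pointwise unions). $J$ sends a function $f\colon X\to Y$ to $x\mapsto\{(\tau,f(x))\}$. $\mathbb{T}^\ast$ is the free monoid on $\mathbb{T}$. A lax functor $\pi$ from a monoid $M$ to $\mathbf{K}$ is a set $\pi(\ast)$ with endomorphisms $\pi_m$ of $\mathbf{K}$ such that $id\leq\pi_1$, $\pi_m\circ\pi_{m'}\leq\pi_{mm'}$. The functor model $\underline{\alpha}$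 is the functor $\mathbb{T}^\ast\to\mathbf{K}$ with $\underline{\alpha}(\ast)=X$, $\underline{\alpha}_t(x)=\{(\sigma,y)\mid(\sigma,t,y)\in\alpha(x)\}$ for $t\in\mathbb{T}$, $\underline{\alpha}_{t_1\dots t_k}=\underline{\alpha}_{t_1}\circ\cdots\circ\underline{\alpha}_{t_k}$, and $\underline{\alpha}$ of the empty word the identity. For a surjective monoid homomorphism $q\colon M\to N$ and lax functor $\pi$ from $M$, $\Sigma_q(\pi)$ is the lax functor from $N$ with carrier $\pi(\ast)$ and $\Sigma_q(\pi)_n=\bigvee_{i<\omega}\Pi_{n,i}$, $\Pi_{n,0}=\bigvee\{\pi_m\mid q(m)=n\}$, $\Pi_{n,i+1}=\bigvee\{\Pi_{n_1,i}\circ\cdots\circ\Pi_{n_l,i}\mid l\ge1,\ n_1\cdots n_l=n\}$. An equivalence relation $R$ on $\pi(\ast)$ is a $q$-bisimulation for $\pi$ if there are a set $Y$, a function $f\colon\pi(\ast)\to Y$ with $R=\{(x,x')\mid f(x)=f(x')\}$, and a lax functor $\pi'$ from $N$ to $\mathbf{K}$ with $\pi'(\ast)=Y$ such that $J(f)\circ\Sigma_q(\pi)_n=\pi'_n\circ J(f)$ for all $n\in N$. Here $q=id_{\mathbb{T}^\ast}$. -}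

module Defs where

open import Data.Product using (Σ; ∃; _×_; _,_)
open import Data.Sum using (_⊎_)
open import Data.Nat using (ℕ; zero; suc)
open import Data.List using (List; []; _∷_; _++_)
open import Data.List.Properties using (++-isMonoid)
open import Function using (id)
open import Function.Bundles using (_⇔_)
open import Relation.Binary.PropositionalEquality using (_≡_; refl)
open import Algebra.Structures using (IsMonoid)
open import Relation.Binary.Bundles using (Setoid)
open import Level using (0ℓ)

data Act (S : Set) : Set where
  act : S → Act S
  τ   : Act S

TTS : (S T X : Set) → Set₁
TTS S T X = X → Act S × T × X → Set

IsTimedBisim : {S T X : Set} → TTS S T X → (X → X → Set) → Set
IsTimedBisim {S} {T} {X} α R =
  ∀ x y → R x y → ∀ (σ : Act S) (t : T) (x' : X) → α x (σ , t , x') →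
    ∃ λ y' → α y (σ , t , y') × R x' y'

KHom : (S X Y : Set) → Set₁
KHom S X Y = X → Act S × Y → Set

idK : {S X : Set} → KHom S X X
idK x (a , y) = (a ≡ τ) × (y ≡ x)

_∘K_ : {S X Y Z : Set} → KHom S Y Z → KHom S X Y → KHom S X Z
_∘K_ {Y = Y} g f x (σ , z) =
  ∃ λ (y : Y) → (f x (σ , y) × g y (τ , z)) ⊎ (f x (τ , y) × g y (σ , z))

_≤K_ : {S X Y : Set} → KHom S X Y → KHom S X Y → Set
f ≤K g = ∀ x p → f x p → g x p

_≐K_ : {S X Y : Set} → KHom S X Y → KHom S X Y → Set
f ≐K g = (f ≤K g) × (g ≤K f)

J : {S X Y : Set} → (X → Y) → KHom S X Y
J f x (a , y) = (a ≡ τ) × (f x ≡ y)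

record Mon : Set₁ where
  field
    Carrier  : Set
    _∙_      : Carrier → Carrier → Carrier
    ε        : Carrier
    isMonoid : IsMonoid _≡_ _∙_ ε

record SurjHom (M N : Mon) : Set where
  private
    module M = Mon M
    module N = Mon N
  field
    fun   : M.Carrier → N.Carrier
    hom-∙ : ∀ m m' → fun (M._∙_ m m') ≡ N._∙_ (fun m) (fun m')
    hom-ε : fun M.ε ≡ N.ε
    surj  : ∀ n → ∃ λ m → fun m ≡ n

FreeMon : Set → Mon
FreeMon T = record
  { Carrier = List T ; _∙_ = _++_ ; ε = [] ; isMonoid = ++-isMonoid }

idHom : (M : Mon) → SurjHom M M
idHom M = record
  { fun = id ; hom-∙ = λ _ _ → refl ; hom-ε = refl ; surj = λ n → n , refl }

-- Lax functors from a monoid M to K, with a given carrier π(*) = C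

record LaxFunctor (S : Set) (M : Mon) (C : Set) : Set₁ where
  open Mon M
  field
    map   : Carrier → KHom S C C
    id≤   : idK ≤K map ε
    comp≤ : ∀ m m' → (map m ∘K map m') ≤K map (m ∙ m')

module _ {S : Set} {M N : Mon} (q : SurjHom M N) {C : Set}
         (π : Mon.Carrier M → KHom S C C) where
  private
    module M = Mon M
    module N = Mon N
    open SurjHom q using (fun)

  -- n₁ ⋯ nₗ  (l ≥ 1), given as n₁ and [n₂,…,nₗ]
  prod⁺ : N.Carrier → List N.Carrier → N.Carrier
  prod⁺ n []       = n
  prod⁺ n (m ∷ ms) = N._∙_ n (prod⁺ m ms)

  comp⁺ : (N.Carrier → KHom S C C) → N.Carrier → List N.Carrier → KHom S C C
  comp⁺ F n []       = F n
  comp⁺ F n (m ∷ ms) = F n ∘K comp⁺ F m ms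

  Π : N.Carrier → ℕ → KHom S C C
  Π n zero    x p = ∃ λ m → (fun m ≡ n) × π m x p
  Π n (suc i) x p =
    ∃ λ n₁ → ∃ λ ns → (prod⁺ n₁ ns ≡ n) × comp⁺ (λ k → Π k i) n₁ ns x p

  Σq : N.Carrier → KHom S C C
  Σq n x p = ∃ λ i → Π n i x p

-- q-bisimulation for a (lax) functor π from M with carrier X
-- (only the family of endomorphisms π_m enters the definition)

-- J(f) for f into a setoid Y (quotients are rendered as setoids)
JS : {S X : Set} (Y : Setoid 0ℓ 0ℓ) → (X → Setoid.Carrier Y) → KHom S X (Setoid.Carrier Y)
JS Y f x (a , y) = (a ≡ τ) × Setoid._≈_ Y (f x) y

Respects≈ : {S : Set} (Y : Setoid 0ℓ 0ℓ) → KHom S (Setoid.Carrier Y) (Setoid.Carrier Y) → Set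
Respects≈ Y g = ∀ y y' a z z' → Setoid._≈_ Y y y' → Setoid._≈_ Y z z' → g y (a , z) → g y' (a , z')

IsQBisim : {S : Set} {M N : Mon} (q : SurjHom M N) {X : Set}
           (π : Mon.Carrier M → KHom S X X) (R : X → X → Set) → Set₁
IsQBisim {S} {M} {N} q {X} π R =
  Σ (Setoid 0ℓ 0ℓ) λ Y → Σ (X → Setoid.Carrier Y) λ f →
    (∀ x x' → R x x' ⇔ Setoid._≈_ Y (f x) (f x')) ×
    Σ (LaxFunctor S N (Setoid.Carrier Y)) λ π' →
      (∀ n → Respects≈ Y (LaxFunctor.map π' n)) ×
      (∀ n → (JS Y f ∘K Σq q π n) ≐K (LaxFunctor.map π' n ∘K JS Y f))

αstep : {S T X : Set} → TTS S T X → T → KHom S X X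
αstep α t x (σ , y) = α x (σ , t , y)

αmodel : {S T X : Set} → TTS S T X → List T → KHom S X X
αmodel α []            = idK
αmodel α (t ∷ [])      = αstep α t
αmodel α (t ∷ t' ∷ ts) = αstep α t ∘K αmodel α (t' ∷ ts)

module Submission where

-- A relation R on X is a timed bisimulation for α exactly when every step
-- morphism ᾱ_t = αstep α t of K "R-simulates": R x y and x →(a) x' give
-- y →(a) y' with R x' y'.  The proof of Proposition 6.1 rests on three
-- general facts about K.
--   * Collapse: for q the identity and any lax functor π, Σ_q(π) ≐ π, so in
--     the definition of an id-bisimulation Σ_q(ᾱ) may be replaced by ᾱ.
--   * Quotient (forward direction): if all π_m of a lax functor π R-simulate,
--     for an equivalence R, then "π_m followed by R" is a lax functor π/R on
--     the quotient setoid X/R, and J(id) ∘ π_m ≐ (π/R)_m ∘ J(id).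
--   * Kernel (backward direction): if J(f) ∘ g ≐ h ∘ J(f) with h respecting
--     the setoid equality, then g R-simulates for the kernel R of f.
-- R-simulating morphisms are closed under identity and composition, so all
-- ᾱ_w simulate when the steps do; the theorem follows by combining these.

open import Defs
open import Function using (id)
open import Function.Bundles using (_⇔_; mk⇔; Equivalence)
open import Relation.Binary.PropositionalEquality using (_≡_; refl)
open import Relation.Binary.Structures using (IsEquivalence)
open import Relation.Binary.Bundles using (Setoid)
open import Algebra.Structures using (IsMonoid)
open import Data.Product using (∃; _×_; _,_)
open import Data.Sum using (inj₁; inj₂)
open import Data.List using ([]; _∷_; _++_)
open import Data.Nat using (zero; suc)
open import Level using (0ℓ)

module _ {S : Set} where

  ≐-trans : {X Y : Set} {f g h : KHom S X Y} → f ≐K g → g ≐K h → f ≐K h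
  ≐-trans (f≤g , g≤f) (g≤h , h≤g) =
    (λ x p u → g≤h x p (f≤g x p u)) , (λ x p u → g≤f x p (h≤g x p u))

  ∘-mono : {X Y Z : Set} {f f' : KHom S X Y} {g g' : KHom S Y Z} →
           f ≤K f' → g ≤K g' → (g ∘K f) ≤K (g' ∘K f')
  ∘-mono f≤ g≤ x _ (y , inj₁ (fy , gz)) = y , inj₁ (f≤ x _ fy , g≤ y _ gz)
  ∘-mono f≤ g≤ x _ (y , inj₂ (fy , gz)) = y , inj₂ (f≤ x _ fy , g≤ y _ gz)

  ∘-congʳ : {X Y Z : Set} {f f' : KHom S X Y} (g : KHom S Y Z) →
            f ≐K f' → (g ∘K f) ≐K (g ∘K f')
  ∘-congʳ g (f≤f' , f'≤f) =
    ∘-mono f≤f' (λ _ _ u → u) , ∘-mono f'≤f (λ _ _ u → u)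

  ∘-assoc : {X Y Z W : Set} {h : KHom S X Y} {f : KHom S Y Z} {g : KHom S Z W} →
            ((g ∘K f) ∘K h) ≤K (g ∘K (f ∘K h))
  ∘-assoc x _ (y , inj₁ (hy , (w , inj₁ (fw , gz)))) = w , inj₁ ((y , inj₁ (hy , fw)) , gz)
  ∘-assoc x _ (y , inj₁ (hy , (w , inj₂ (fw , gz)))) = w , inj₁ ((y , inj₁ (hy , fw)) , gz)
  ∘-assoc x _ (y , inj₂ (hy , (w , inj₁ (fw , gz)))) = w , inj₁ ((y , inj₂ (hy , fw)) , gz)
  ∘-assoc x _ (y , inj₂ (hy , (w , inj₂ (fw , gz)))) = w , inj₂ ((y , inj₁ (hy , fw)) , gz)

  ∘-identityˡ : {X Y : Set} {f : KHom S X Y} → (idK ∘K f) ≤K f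
  ∘-identityˡ x _ (y , inj₁ (fy , refl , refl)) = fy
  ∘-identityˡ x _ (y , inj₂ (fy , refl , refl)) = fy

  ∘-identityʳ : {X Y : Set} {f : KHom S X Y} → (f ∘K idK) ≤K f
  ∘-identityʳ x _ (y , inj₁ ((refl , refl) , fy)) = fy
  ∘-identityʳ x _ (y , inj₂ ((refl , refl) , fy)) = fy

  -- Composites with J(f) on either side, unfolded: J(f) only relabels the
  -- target by f (and carries τ), so it can be absorbed into the other factor.
  module _ {X : Set} (Y : Setoid 0ℓ 0ℓ) (f : X → Setoid.Carrier Y) where
    open Setoid Y using (_≈_) renaming (refl to ≈-refl; sym to ≈-sym)

    after-J-intro : {Z : Set} (g : KHom S Z X) {z : Z} {a : Act S} {x : X}
                    {y : Setoid.Carrier Y} → g z (a , x) → f x ≈ y →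
                    (JS Y f ∘K g) z (a , y)
    after-J-intro g gx fx≈y = _ , inj₁ (gx , refl , fx≈y)

    after-J-elim : {Z : Set} (g : KHom S Z X) {z : Z} {a : Act S}
                   {y : Setoid.Carrier Y} → (JS Y f ∘K g) z (a , y) →
                   ∃ λ x → g z (a , x) × f x ≈ y
    after-J-elim g (x , inj₁ (gx , refl , fx≈y)) = x , gx , fx≈y
    after-J-elim g (x , inj₂ (gx , refl , fx≈y)) = x , gx , fx≈y

    before-J-intro : {Z : Set} (h : KHom S (Setoid.Carrier Y) Z) {x : X}
                     {a : Act S} {z : Z} → h (f x) (a , z) → (h ∘K JS Y f) x (a , z)
    before-J-intro h hz = _ , inj₂ ((refl , ≈-refl) , hz)

    before-J-elim : (h : KHom S (Setoid.Carrier Y) (Setoid.Carrier Y)) →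
                    Respects≈ Y h → {x : X} {a : Act S} {z : Setoid.Carrier Y} →
                    (h ∘K JS Y f) x (a , z) → h (f x) (a , z)
    before-J-elim h resp (w , inj₁ ((refl , fx≈w) , hz)) = resp _ _ _ _ _ (≈-sym fx≈w) ≈-refl hz
    before-J-elim h resp (w , inj₂ ((refl , fx≈w) , hz)) = resp _ _ _ _ _ (≈-sym fx≈w) ≈-refl hz

  Simulates : {X : Set} → (X → X → Set) → KHom S X X → Set
  Simulates R g = ∀ x y a x' → R x y → g x (a , x') → ∃ λ y' → g y (a , y') × R x' y'

  module _ {X : Set} {R : X → X → Set} where

    simulates-id : Simulates R idK
    simulates-id x y _ _ xRy (refl , refl) = y , (refl , refl) , xRy

    simulates-∘ : {g f : KHom S X X} → Simulates R g → Simulates R f →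
                  Simulates R (g ∘K f)
    simulates-∘ sim-g sim-f x y a x' xRy (w , inj₁ (fw , gx'))
      with sim-f x y a w xRy fw
    ... | w' , fw' , wRw' with sim-g w w' τ x' wRw' gx'
    ... | y' , gy' , x'Ry' = y' , (w' , inj₁ (fw' , gy')) , x'Ry'
    simulates-∘ sim-g sim-f x y a x' xRy (w , inj₂ (fw , gx'))
      with sim-f x y τ w xRy fw
    ... | w' , fw' , wRw' with sim-g w w' a x' wRw' gx'
    ... | y' , gy' , x'Ry' = y' , (w' , inj₂ (fw' , gy')) , x'Ry'

    simulates-≐ : {g g' : KHom S X X} → g ≐K g' → Simulates R g → Simulates R g'
    simulates-≐ (g≤g' , g'≤g) sim x y a x' xRy g'x' with sim x y a x' xRy (g'≤g x _ g'x')
    ... | y' , gy' , x'Ry' = y' , g≤g' y _ gy' , x'Ry'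

  -- Each level
  -- Π_{n,i} is a union of composites π_{n₁} ∘ ⋯ ∘ π_{nₗ} with n₁⋯nₗ = n,
  -- which laxness bounds by π_n; conversely π_n is Π_{n,0}.
  module _ {M : Mon} {C : Set} (π : LaxFunctor S M C) where
    open LaxFunctor π using (map; comp≤)

    private
      q : SurjHom M M
      q = idHom M

    Π≤map : ∀ n i → Π q map n i ≤K map n
    comp⁺≤map : ∀ i n ns → comp⁺ q map (λ k → Π q map k i) n ns ≤K map (prod⁺ q map n ns)
    Π≤map n zero    x p (m , refl , πm) = πm
    Π≤map n (suc i) x p (n₁ , ns , refl , u) = comp⁺≤map i n₁ ns x p u
    comp⁺≤map i n []       = Π≤map n i
    comp⁺≤map i n (m ∷ ms) x p u =
      comp≤ n (prod⁺ q map m ms) x p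
        (∘-mono {f = comp⁺ q map (λ k → Π q map k i) m ms} {g = Π q map n i}
                (comp⁺≤map i m ms) (Π≤map n i) x p u)

    Σid-collapse : ∀ n → Σq q map n ≐K map n
    Σid-collapse n = (λ x p (i , u) → Π≤map n i x p u) , (λ x p u → 0 , n , refl , u)

  module Quotient {M : Mon} {X : Set} (π : LaxFunctor S M X)
                  {R : X → X → Set} (R-equiv : IsEquivalence R)
                  (sim : ∀ m → Simulates R (LaxFunctor.map π m)) where
    open Mon M using (Carrier)
    open LaxFunctor π using (map; id≤; comp≤)
    open IsEquivalence R-equiv renaming (refl to R-refl; sym to R-sym; trans to R-trans)

    X/R : Setoid 0ℓ 0ℓ
    X/R = record { Carrier = X ; _≈_ = R ; isEquivalence = R-equiv }

    map/R : Carrier → KHom S X X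
    map/R m x (a , z) = ∃ λ z₀ → map m x (a , z₀) × R z₀ z

    map/R-resp : ∀ m → Respects≈ X/R (map/R m)
    map/R-resp m y y' a z z' yRy' zRz' (z₀ , πz₀ , z₀Rz) with sim m y y' a z₀ yRy' πz₀
    ... | z₁ , πz₁ , z₀Rz₁ = z₁ , πz₁ , R-trans (R-sym z₀Rz₁) (R-trans z₀Rz zRz')

    -- the R-step between the two factors is pushed through π_m by simulation
    map/R-comp : ∀ m m' → (map/R m ∘K map/R m') ≤K map/R (Mon._∙_ M m m')
    map/R-comp m m' x (σ , z) (y , inj₁ ((z₀ , π'z₀ , z₀Ry) , (z₁ , πz₁ , z₁Rz)))
      with sim m y z₀ τ z₁ (R-sym z₀Ry) πz₁
    ... | z₂ , πz₂ , z₁Rz₂ =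
      z₂ , comp≤ m m' x _ (z₀ , inj₁ (π'z₀ , πz₂)) , R-trans (R-sym z₁Rz₂) z₁Rz
    map/R-comp m m' x (σ , z) (y , inj₂ ((z₀ , π'z₀ , z₀Ry) , (z₁ , πz₁ , z₁Rz)))
      with sim m y z₀ σ z₁ (R-sym z₀Ry) πz₁
    ... | z₂ , πz₂ , z₁Rz₂ =
      z₂ , comp≤ m m' x _ (z₀ , inj₂ (π'z₀ , πz₂)) , R-trans (R-sym z₁Rz₂) z₁Rz

    π/R : LaxFunctor S M X
    π/R = record
      { map   = map/R
      ; id≤   = λ x p u → _ , id≤ x p u , R-refl
      ; comp≤ = map/R-comp
      }

    intertwines : ∀ m → (JS X/R id ∘K map m) ≐K (map/R m ∘K JS X/R id)
    intertwines m =
      (λ x p u → before-J-intro X/R id (map/R m) (after-J-elim X/R id (map m) u)) ,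
      (λ x p u → let (y , πy , yRz) = before-J-elim X/R id (map/R m) (map/R-resp m) u
                 in after-J-intro X/R id (map m) πy yRz)

  kernel-simulates : {X : Set} (Y : Setoid 0ℓ 0ℓ) (f : X → Setoid.Carrier Y)
                     {R : X → X → Set} → (∀ x x' → R x x' ⇔ Setoid._≈_ Y (f x) (f x')) →
                     (g : KHom S X X) (h : KHom S (Setoid.Carrier Y) (Setoid.Carrier Y)) →
                     Respects≈ Y h → (JS Y f ∘K g) ≐K (h ∘K JS Y f) → Simulates R g
  kernel-simulates Y f {R} R⇔ g h h-resp (Jg≤hJ , hJ≤Jg) x y a x' xRy gx' =
    conclude (after-J-elim Y f g (hJ≤Jg y _ (before-J-intro Y f h h-at-fy)))
    where
    open Setoid Y renaming (refl to ≈-refl; sym to ≈-sym)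
    h-at-fx : h (f x) (a , f x')
    h-at-fx = before-J-elim Y f h h-resp (Jg≤hJ x _ (after-J-intro Y f g gx' ≈-refl))
    h-at-fy : h (f y) (a , f x')
    h-at-fy = h-resp _ _ _ _ _ (Equivalence.to (R⇔ x y) xRy) ≈-refl h-at-fx
    conclude : (∃ λ y' → g y (a , y') × f y' ≈ f x') → ∃ λ y' → g y (a , y') × R x' y'
    conclude (y' , gy' , fy'≈fx') = y' , gy' , Equivalence.from (R⇔ x' y') (≈-sym fy'≈fx')

  module _ {T X : Set} (α : TTS S T X) where

    timedBisim⇔steps : (R : X → X → Set) →
                       IsTimedBisim α R ⇔ (∀ t → Simulates R (αstep α t))
    timedBisim⇔steps R =
      mk⇔ (λ bis t x y a x' xRy → bis x y xRy a t x')
          (λ sim x y xRy a t x' → sim t x y a x' xRy)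

    αmodel-comp : ∀ u v → (αmodel α u ∘K αmodel α v) ≤K αmodel α (u ++ v)
    αmodel-comp []           v        = ∘-identityˡ
    αmodel-comp (t ∷ [])     []       = ∘-identityʳ
    αmodel-comp (t ∷ [])     (_ ∷ _)  = λ _ _ u → u
    αmodel-comp (t ∷ t' ∷ u) v x p w =
      ∘-mono {f = αmodel α (t' ∷ u) ∘K αmodel α v} {g = αstep α t}
        (αmodel-comp (t' ∷ u) v) (λ _ _ s → s) x p
        (∘-assoc {h = αmodel α v} {f = αmodel α (t' ∷ u)} {g = αstep α t} x p w)

    αmodel-lax : LaxFunctor S (FreeMon T) X
    αmodel-lax = record
      { map = αmodel α ; id≤ = λ _ _ u → u ; comp≤ = αmodel-comp }

    αmodel-simulates : {R : X → X → Set} → (∀ t → Simulates R (αstep α t)) →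
                       ∀ w → Simulates R (αmodel α w)
    αmodel-simulates sim []           = simulates-id
    αmodel-simulates sim (t ∷ [])     = sim t
    αmodel-simulates sim (t ∷ t' ∷ w) = simulates-∘ (sim t) (αmodel-simulates sim (t' ∷ w))

-- Proposition 6.1.  Forward: the steps simulate, hence so does all of ᾱ, and
-- ᾱ descends to X/R; by the collapse Σ_id(ᾱ) may replace ᾱ in the equation.
-- Backward: by the kernel lemma Σ_id(ᾱ)_t, i.e. ᾱ_t, simulates R.
proposition6p1 : {S T : Set} (_·_ : T → T → T) (e : T) → IsMonoid _≡_ _·_ e →
    (X : Set) (α : TTS S T X) (R : X → X → Set) → IsEquivalence R →
    IsTimedBisim α R ⇔ IsQBisim (idHom (FreeMon T)) (αmodel α) R
proposition6p1 {T = T} _ _ _ X α R R-equiv = mk⇔ forward backward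
  where
  collapse : ∀ w → Σq (idHom (FreeMon T)) (αmodel α) w ≐K αmodel α w
  collapse = Σid-collapse (αmodel-lax α)

  forward : IsTimedBisim α R → IsQBisim (idHom (FreeMon T)) (αmodel α) R
  forward bis =
    X/R , id , (λ _ _ → mk⇔ id id) , π/R , map/R-resp ,
    (λ w → ≐-trans (∘-congʳ (JS X/R id) (collapse w)) (intertwines w))
    where
    open Quotient (αmodel-lax α) R-equiv
      (αmodel-simulates α (Equivalence.to (timedBisim⇔steps α R) bis))

  backward : IsQBisim (idHom (FreeMon T)) (αmodel α) R → IsTimedBisim α R
  backward (Y , f , R⇔ , π' , π'-resp , intertwined) =
    Equivalence.from (timedBisim⇔steps α R) λ t →
      simulates-≐ (collapse (t ∷ []))
        (kernel-simulates Y f R⇔ (Σq (idHom (FreeMon T)) (αmodel α) (t ∷ []))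
          (LaxFunctor.map π' (t ∷ [])) (π'-resp (t ∷ [])) (intertwined (t ∷ [])))
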